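{- Let $p$ be a positive integer and let $J\triangleleft\mathbf k[x_1,x_2,x_3]$ be a stable monomial ideal with constant affine Hilbert polynomial $p$; let $(p,h,k)$ be the bar list of the Bar Code of $\mathsf N(J)$. Then $1\le k\le l$, where $l=\max\{i\in\mathbb N : i^3+3i^2+2i\le 6p\}$, and $\frac{k(k+1)}{2}\le h\le m$, where $m=\max\{r\ge \frac{k(k+1)}{2} : \text{there exists }\lambda\in I_{(r,k)}\text{ with }\mathrm{Sm}(\lambda)\le p\}$.
   Context: $\mathbf k$ is a field of characteristic $0$; terms ordered lexicographically with $x_1<x_2<x_3$. A monomial ideal $J$ is stable if for every term $\tau\in J$ and every variable $x_j>\min(\tau)$ (smallest variable dividing $\tau$), $x_j\tau/\min(\tau)\in J$. Affine Hilbert polynomial: the polynomial agreeing for large $d$ with $d\mapsto\dim_{\mathbf k}\mathcal P(d)/J(d)$ ($\mathcal P(d)$ polynomials of degree $\le d$, $J(d)=J\cap\mathcal P(d)$); for monomial $J$ with finite $\mathsf N(J)$ (terms not in $J$) it equals $|\mathsf N(J)|$. For a finite set $M$ of terms, its bar list is $(\mu(1),\mu(2),\mu(3))$ with $\mu(1)=|M|$, $\mu(2)=|\{x_2^{\gamma_2}x_3^{\gamma_3} : x_1^{\gamma_1}x_2^{\gamma_2}x_3^{\gamma_3}\in M\}|$, $\mu(3)=|\{x_3^{\gamma_3}: x^\gamma\in M\}|$ (the numbers of bars in the rows of its Bar Code). $I_{(r,k)}$ is the set of $(\lambda_1,\dots,\lambda_k)\in\mathbb N^k$ with $\lambda_1>\dots>\lambda_k>0$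 and $\sum\lambda_j=r$. For a list of positive integers, $\mathrm{Sm}([\alpha_1,\dots,\alpha_g])=\sum_{i=1}^g\frac{\alpha_i(\alpha_i+1)}{2}$. -}

module Defs where

open import Data.Nat using (ℕ; zero; suc; _+_; _*_; _∸_; _^_; _≤_; _<_; _>_)
open import Data.Nat.DivMod using (_/_)
open import Data.Bool using (Bool; true; false; not)
open import Data.Product using (_×_; _,_; ∃-syntax)
open import Data.List using (List; []; _∷_; length; map; filter; concatMap; upTo)
open import Data.Bool.ListAction using (any)
open import Data.Nat.ListAction using (sum)
open import Data.List.Relation.Unary.All using (All)
open import Data.List.Relation.Unary.Linked using (Linked)
open import Relation.Binary.PropositionalEquality using (_≡_)
open import Relation.Nullary.Decidable using (does)
open import Relation.Nullary using (Dec)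
open import Function using (_∘_)

-- A term x1^a x2^b x3^c is represented by its exponent triple (a , b , c).
Term : Set
Term = ℕ × ℕ × ℕ

-- A set of terms, given by its (Boolean) membership predicate.
-- A monomial ideal of k[x1,x2,x3] is determined by the set of terms it contains;
-- "J t ≡ true" means the term t lies in J.
TermSet : Set
TermSet = Term → Bool

IsMonomialIdeal : TermSet → Set
IsMonomialIdeal J = ∀ a b c → J (a , b , c) ≡ true →
  (J (suc a , b , c) ≡ true) × (J (a , suc b , c) ≡ true) × (J (a , b , suc c) ≡ true)

-- Stability w.r.t. x1 < x2 < x3: for τ ∈ J and every variable x_j > min(τ),
-- x_j τ / min(τ) ∈ J.  (min(τ) = x1 when a > 0; = x2 when a = 0, b > 0.)
IsStable : TermSet → Set
IsStable J =
  (∀ a b c → J (suc a , b , c) ≡ true →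
     (J (a , suc b , c) ≡ true) × (J (a , b , suc c) ≡ true)) ×
  (∀ b c → J (0 , suc b , c) ≡ true → J (0 , b , suc c) ≡ true)

isTrue : (b : Bool) → Dec (b ≡ true)
isTrue b = b Data.Bool.≟ true

termsUpTo : ℕ → List Term
termsUpTo d =
  concatMap (λ a → concatMap (λ b → map (λ c → (a , b , c)) (upTo (suc (d ∸ a ∸ b))))
                             (upTo (suc (d ∸ a))))
            (upTo (suc d))

-- affine Hilbert function: d ↦ dim P(d)/J(d) = #{terms of degree ≤ d not in J}
affineHF : TermSet → ℕ → ℕ
affineHF J d = length (filter (λ t → isTrue (not (J t))) (termsUpTo d))

HasConstantHilbertPolynomial : TermSet → ℕ → Set
HasConstantHilbertPolynomial J p = ∃[ d₀ ] (∀ d → d₀ ≤ d → affineHF J d ≡ p)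

-- Second and third entries of the bar list of N(J), computed inside the box of
-- exponents ≤ d:
--   μ2 = #{ x2^b x3^c : some x1^a x2^b x3^c ∈ N(J) },
--   μ3 = #{ x3^c : some x1^a x2^b x3^c ∈ N(J) }.
mu2UpTo : TermSet → ℕ → ℕ
mu2UpTo J d = length (filter (λ bc → isTrue (anyA bc))
                (concatMap (λ b → map (λ c → (b , c)) (upTo (suc d))) (upTo (suc d))))
  where
  anyA : ℕ × ℕ → Bool
  anyA (b , c) = any (λ a → not (J (a , b , c))) (upTo (suc d))

mu3UpTo : TermSet → ℕ → ℕ
mu3UpTo J d = length (filter (λ c → isTrue (anyAB c)) (upTo (suc d)))
  where
  anyAB : ℕ → Bool
  anyAB c = any (λ a → any (λ b → not (J (a , b , c))) (upTo (suc d))) (upTo (suc d))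

IsBarListOfN : TermSet → ℕ → ℕ → ℕ → Set
IsBarListOfN J p h k = ∃[ d₀ ] (∀ d → d₀ ≤ d →
  (affineHF J d ≡ p) × (mu2UpTo J d ≡ h) × (mu3UpTo J d ≡ k))

IsMax : (ℕ → Set) → ℕ → Set
IsMax P n = P n × (∀ i → P i → i ≤ n)

InI : ℕ → ℕ → List ℕ → Set
InI r k λs = (length λs ≡ k) × Linked _>_ λs × All (λ x → 0 < x) λs × (sum λs ≡ r)

Sm : List ℕ → ℕ
Sm αs = sum (map (λ a → (a * (a + 1)) / 2) αs)

LCond : ℕ → ℕ → Set
LCond p i = i ^ 3 + 3 * i ^ 2 + 2 * i ≤ 6 * p

MCond : ℕ → ℕ → ℕ → Set
MCond p k r = ((k * (k + 1)) / 2 ≤ r) × ∃[ λs ] (InI r k λs × (Sm λs ≤ p))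

-- N(J) is an order ideal of ℕ³ that, by stability, is also closed under the moves x₂ ↦ x₁ and
-- x₃ ↦ x₂.  Let k be its height along x₃ and r_c the number of terms x₂^b x₃^c in N(J), c < k.
-- Stability gives r₀ > r₁ > … > r_{k-1} with r_c ≥ k − c, and the slice of N(J) at height c
-- contains the whole triangle x₁^a x₂^b x₃^c, a + b < r_c, of r_c(r_c+1)/2 terms.  Hence
-- (r₀, …, r_{k-1}) ∈ I_(h,k) with Sm ≤ p, which gives k(k+1)/2 ≤ h ≤ m, and
-- Σ_{c<k} (k−c)(k−c+1)/2 = k(k+1)(k+2)/6 ≤ p gives k ≤ l.  Everything is counted in a box
-- [0,d]³ with d ≥ p; it contains N(J), since a full row of d + 1 terms would already exceed p.

module Submission where

open import Defs
open import Data.Nat using (ℕ; _≤_; _*_; _+_)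
open import Data.Nat.DivMod using (_/_)
open import Data.Product using (_×_; ∃-syntax)

open import Algebra.Properties.CommutativeSemigroup using (interchange)
open import Data.Bool using (Bool; true; false; not; _∨_)
open import Data.Bool.ListAction using (any; or)
open import Data.Empty using (⊥-elim)
open import Data.List using (List; []; _∷_; _++_; length; map; filter; concatMap; upTo; applyUpTo)
open import Data.List.Properties using (length-++; filter-++; map-upTo; map-applyUpTo; map-cong; length-applyUpTo)
open import Data.List.Relation.Unary.All as All using (All; []; _∷_; all?)
open import Data.List.Relation.Unary.All.Properties using (applyUpTo⁺₁)
open import Data.List.Relation.Unary.Linked using (Linked; []; [-]; _∷_; linked?)
open import Data.Nat using (zero; suc; _∸_; _^_; _<_; _≤′_; ≤′-refl; ≤′-step; z≤n; s≤s; z<s; s<s)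
open import Data.Nat.DivMod using (m*n/n≡m)
open import Data.Nat.ListAction using (sum)
open import Data.Nat.Properties
open import Data.Nat.Tactic.RingSolver using (solve-∀)
open import Data.Product using (_,_; proj₁; proj₂)
open import Data.Sum using (inj₁; inj₂)
open import Function using (_∘_; id)
open import Relation.Binary.PropositionalEquality
open import Relation.Nullary using (Dec; yes; no; ¬_)
open import Relation.Nullary.Decidable using (map′; _×-dec_; decidable-stable)
open import Relation.Unary using (Decidable)

-- Opaque, so that unification recovers the summand f from ∑< n f.
opaque
  ∑< : ℕ → (ℕ → ℕ) → ℕ
  ∑< n f = sum (applyUpTo f n)

syntax ∑< n (λ i → e) = ∑[ i < n ] e

opaque
  unfolding ∑<

  ∑-as-sum : ∀ n f → ∑< n f ≡ sum (applyUpTo f n)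
  ∑-as-sum n f = refl

  ∑-suc : ∀ n f → ∑< (suc n) f ≡ f 0 + ∑[ i < n ] f (suc i)
  ∑-suc n f = refl

  ∑-one : ∀ n → ∑[ i < n ] 1 ≡ n
  ∑-one zero = refl
  ∑-one (suc n) = cong suc (∑-one n)

  ∑-cong : ∀ {n f g} → (∀ i → i < n → f i ≡ g i) → ∑< n f ≡ ∑< n g
  ∑-cong {zero} _ = refl
  ∑-cong {suc n} f≡g = cong₂ _+_ (f≡g 0 z<s) (∑-cong (λ i i<n → f≡g (suc i) (s<s i<n)))

  ∑-mono : ∀ {m n f g} → m ≤ n → (∀ i → i < m → f i ≤ g i) → ∑< m f ≤ ∑< n g
  ∑-mono {zero} _ _ = z≤n
  ∑-mono {suc m} {suc n} (s≤s m≤n) f≤g =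
    +-mono-≤ (f≤g 0 z<s) (∑-mono m≤n (λ i i<m → f≤g (suc i) (s<s i<m)))

  term≤∑ : ∀ {n f i} → i < n → f i ≤ ∑< n f
  term≤∑ {suc n} {f} {zero} _ = m≤m+n (f 0) _
  term≤∑ {suc n} {f} {suc i} (s<s i<n) = ≤-trans (term≤∑ {f = f ∘ suc} i<n) (m≤n+m _ (f 0))

  ∑-zero : ∀ {n f} → (∀ i → i < n → f i ≡ 0) → ∑< n f ≡ 0
  ∑-zero {zero} _ = refl
  ∑-zero {suc n} f≡0 = cong₂ _+_ (f≡0 0 z<s) (∑-zero (λ i i<n → f≡0 (suc i) (s<s i<n)))

  ∑-vanishing : ∀ {m n f} → m ≤ n → (∀ i → m ≤ i → i < n → f i ≡ 0) → ∑< n f ≡ ∑< m f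
  ∑-vanishing {zero} _ f≡0 = ∑-zero (λ i → f≡0 i z≤n)
  ∑-vanishing {suc m} {suc n} {f} (s≤s m≤n) f≡0 =
    cong (f 0 +_) (∑-vanishing m≤n (λ i m≤i i<n → f≡0 (suc i) (s≤s m≤i) (s<s i<n)))

  ∑-snoc : ∀ n f → ∑< (suc n) f ≡ ∑< n f + f n
  ∑-snoc zero f = +-comm (f 0) 0
  ∑-snoc (suc n) f = trans (cong (f 0 +_) (∑-snoc n (f ∘ suc))) (sym (+-assoc (f 0) _ _))

  ∑-+ : ∀ n f g → ∑< n f + ∑< n g ≡ ∑[ i < n ] (f i + g i)
  ∑-+ zero f g = refl
  ∑-+ (suc n) f g = trans (interchange +-commutativeSemigroup (f 0) _ (g 0) _)
                          (cong (f 0 + g 0 +_) (∑-+ n (f ∘ suc) (g ∘ suc)))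

  ∑-comm : ∀ m n (f : ℕ → ℕ → ℕ) → ∑[ i < m ] ∑[ j < n ] f i j ≡ ∑[ j < n ] ∑[ i < m ] f i j
  ∑-comm zero n f = sym (∑-zero {n} (λ _ _ → refl))
  ∑-comm (suc m) n f = trans (cong (∑< n (f 0) +_) (∑-comm m n (f ∘ suc))) (∑-+ n (f 0) _)

∑-lower : ∀ {m n f} → m ≤ n → (∀ i → i < m → 1 ≤ f i) → m ≤ ∑< n f
∑-lower {m} m≤n 1≤f = subst (_≤ _) (∑-one m) (∑-mono m≤n 1≤f)

∑-upper : ∀ {n f} → (∀ i → i < n → f i ≤ 1) → ∑< n f ≤ n
∑-upper {n} {f} f≤1 = subst (∑< n f ≤_) (∑-one n) (∑-mono ≤-refl f≤1)

sum-map-upTo : ∀ n f → sum (map f (upTo n)) ≡ ∑< n f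
sum-map-upTo n f = trans (cong sum (map-upTo f n)) (sym (∑-as-sum n f))

𝟙 : Bool → ℕ
𝟙 true = 1
𝟙 false = 0

𝟙≤1 : ∀ x → 𝟙 x ≤ 1
𝟙≤1 true = ≤-refl
𝟙≤1 false = z≤n

1≤𝟙 : ∀ {x} → x ≡ true → 1 ≤ 𝟙 x
1≤𝟙 refl = ≤-refl

𝟙-¬ : ∀ {x} → ¬ x ≡ true → 𝟙 x ≡ 0
𝟙-¬ {false} _ = refl
𝟙-¬ {true} ¬x = ⊥-elim (¬x refl)

𝟙-mono : ∀ {x y} → (x ≡ true → y ≡ true) → 𝟙 x ≤ 𝟙 y
𝟙-mono {false} _ = z≤n
𝟙-mono {true} x⇒y rewrite x⇒y refl = ≤-refl

contraposeᵇ : ∀ {x y} → (x ≡ true → y ≡ true) → not y ≡ true → not x ≡ true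
contraposeᵇ {false} _ _ = refl
contraposeᵇ {true} {true} _ ()
contraposeᵇ {true} {false} x⇒y _ with () ← x⇒y refl

any-true⇒ : ∀ {A : Set} {g : A → Bool} {b} → (∀ {x} → g x ≡ true → b ≡ true) →
            ∀ xs → any g xs ≡ true → b ≡ true
any-true⇒ {g = g} g⇒b (x ∷ xs) any≡true with g x in gx
... | true = g⇒b gx
... | false = any-true⇒ g⇒b xs any≡true

any-head : ∀ {A : Set} {g : A → Bool} {x₀} → (∀ {x} → g x ≡ true → g x₀ ≡ true) →
           ∀ xs → g x₀ ∨ any g xs ≡ g x₀
any-head {g = g} {x₀} g⇒head xs with g x₀ | any g xs in any≡ | any-true⇒ g⇒head xs
... | true | _ | _ = refl
... | false | false | _ = refl
... | false | true | ⇒false with () ← ⇒false any≡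

any-cong : ∀ {A : Set} {f g : A → Bool} → (∀ x → f x ≡ g x) → ∀ xs → any f xs ≡ any g xs
any-cong f≡g xs = cong or (map-cong f≡g xs)

countᵇ : {A : Set} → (A → Bool) → List A → ℕ
countᵇ g xs = length (filter (λ x → isTrue (g x)) xs)

module _ {A : Set} (g : A → Bool) where

  countᵇ-∷ : ∀ x xs → countᵇ g (x ∷ xs) ≡ 𝟙 (g x) + countᵇ g xs
  countᵇ-∷ x xs with g x
  ... | true = refl
  ... | false = refl

  countᵇ-++ : ∀ xs ys → countᵇ g (xs ++ ys) ≡ countᵇ g xs + countᵇ g ys
  countᵇ-++ xs ys = trans (cong length (filter-++ (λ x → isTrue (g x)) xs ys)) (length-++ (filter _ xs))

  countᵇ-concatMap : ∀ {B : Set} (F : B → List A) xs →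
                     countᵇ g (concatMap F xs) ≡ sum (map (countᵇ g ∘ F) xs)
  countᵇ-concatMap F [] = refl
  countᵇ-concatMap F (x ∷ xs) =
    trans (countᵇ-++ (F x) (concatMap F xs)) (cong (countᵇ g (F x) +_) (countᵇ-concatMap F xs))

  countᵇ-applyUpTo : ∀ (f : ℕ → A) n → countᵇ g (applyUpTo f n) ≡ ∑[ i < n ] 𝟙 (g (f i))
  countᵇ-applyUpTo f zero = sym (∑-zero {0} λ _ ())
  countᵇ-applyUpTo f (suc n) = begin
    countᵇ g (applyUpTo f (suc n))                   ≡⟨ countᵇ-∷ (f 0) _ ⟩
    𝟙 (g (f 0)) + countᵇ g (applyUpTo (f ∘ suc) n)  ≡⟨ cong (_ +_) (countᵇ-applyUpTo (f ∘ suc) n) ⟩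
    𝟙 (g (f 0)) + ∑[ i < n ] 𝟙 (g (f (suc i)))      ≡⟨ sym (∑-suc n _) ⟩
    ∑[ i < suc n ] 𝟙 (g (f i))                       ∎
    where open ≡-Reasoning

  countᵇ-map-upTo : ∀ (f : ℕ → A) n → countᵇ g (map f (upTo n)) ≡ ∑[ i < n ] 𝟙 (g (f i))
  countᵇ-map-upTo f n = trans (cong (countᵇ g) (map-upTo f n)) (countᵇ-applyUpTo f n)

  countᵇ-concatMap-upTo : ∀ (F : ℕ → List A) n → countᵇ g (concatMap F (upTo n)) ≡ ∑[ i < n ] countᵇ g (F i)
  countᵇ-concatMap-upTo F n = trans (countᵇ-concatMap F (upTo n)) (sum-map-upTo n _)

antitone-≤ : ∀ {P : ℕ → Set} → (∀ {i} → P (suc i) → P i) → ∀ {i j} → i ≤ j → P j → P i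
antitone-≤ {P} step i≤j = go (≤⇒≤′ i≤j)
  where
  go : ∀ {i j} → i ≤′ j → P j → P i
  go ≤′-refl = id
  go (≤′-step i≤′j) = go i≤′j ∘ step

shift : ∀ {P : ℕ → ℕ → Set} → (∀ {x y} → P x (suc y) → P (suc x) y) → ∀ x {y} → P 0 (x + y) → P x y
shift step zero = id
shift {P} step (suc x) {y} = step ∘ shift {P} step x ∘ subst (P 0) (sym (+-suc x y))

module AntitoneCount (g : ℕ → Bool) (g↓ : ∀ {i} → g (suc i) ≡ true → g i ≡ true) where

  count≤ : ∀ n {i} → ¬ g i ≡ true → ∑[ j < n ] 𝟙 (g j) ≤ i
  count≤ n {i} ¬gi with ≤-total n i
  ... | inj₁ n≤i = ≤-trans (∑-upper (λ j _ → 𝟙≤1 (g j))) n≤i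
  ... | inj₂ i≤n = begin
    ∑[ j < n ] 𝟙 (g j) ≡⟨ ∑-vanishing i≤n (λ j i≤j _ → 𝟙-¬ (¬gi ∘ antitone-≤ g↓ i≤j)) ⟩
    ∑[ j < i ] 𝟙 (g j) ≤⟨ ∑-upper (λ j _ → 𝟙≤1 (g j)) ⟩
    i                  ∎
    where open ≤-Reasoning

  <count⇒true : ∀ n {i} → i < ∑[ j < n ] 𝟙 (g j) → g i ≡ true
  <count⇒true n {i} i<count = decidable-stable (isTrue (g i)) (<⇒≱ i<count ∘ count≤ n)

  true⇒<count : ∀ n {i} → g i ≡ true → i < n → i < ∑[ j < n ] 𝟙 (g j)
  true⇒<count n gi i<n = ∑-lower i<n (λ j j<1+i → 1≤𝟙 (antitone-≤ g↓ (≤-pred j<1+i) gi))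

applyUpTo-Linked : ∀ {A : Set} {R : A → A → Set} (f : ℕ → A) n →
                   (∀ {i} → suc i < n → R (f i) (f (suc i))) → Linked R (applyUpTo f n)
applyUpTo-Linked f zero _ = []
applyUpTo-Linked f (suc zero) _ = [-]
applyUpTo-Linked f (suc (suc n)) R-step = R-step (s<s z<s) ∷ applyUpTo-Linked (f ∘ suc) (suc n) (R-step ∘ s<s)

m<n∸o⇒o+m<n : ∀ {m} n o → m < n ∸ o → o + m < n
m<n∸o⇒o+m<n n zero m<n = m<n
m<n∸o⇒o+m<n (suc n) (suc o) m<n∸o = s<s (m<n∸o⇒o+m<n n o m<n∸o)

tri : ℕ → ℕ
tri zero = 0
tri (suc n) = suc n + tri n

tri*2 : ∀ n → tri n * 2 ≡ n * (n + 1)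
tri*2 zero = refl
tri*2 (suc n) = begin
  (suc n + tri n) * 2        ≡⟨ *-distribʳ-+ 2 (suc n) (tri n) ⟩
  suc n * 2 + tri n * 2      ≡⟨ cong (suc n * 2 +_) (tri*2 n) ⟩
  suc n * 2 + n * (n + 1)    ≡⟨ step n ⟩
  suc n * (suc n + 1)        ∎
  where
  open ≡-Reasoning
  step : ∀ n → (1 + n) * 2 + n * (n + 1) ≡ (1 + n) * ((1 + n) + 1)
  step = solve-∀

tri-closed : ∀ n → (n * (n + 1)) / 2 ≡ tri n
tri-closed n = trans (cong (_/ 2) (sym (tri*2 n))) (m*n/n≡m (tri n) 2)

tri-mono : ∀ {m n} → m ≤ n → tri m ≤ tri n
tri-mono z≤n = z≤n
tri-mono (s≤s m≤n) = s≤s (+-mono-≤ m≤n (tri-mono m≤n))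

n≤tri : ∀ n → n ≤ tri n
n≤tri zero = z≤n
n≤tri (suc n) = m≤m+n (suc n) (tri n)

tri-as-∑ : ∀ n → ∑[ a < n ] (n ∸ a) ≡ tri n
tri-as-∑ zero = ∑-zero {0} λ _ ()
tri-as-∑ (suc n) = trans (∑-suc n _) (cong (suc n +_) (tri-as-∑ n))

tetrahedral : ∀ k → 6 * ∑[ c < k ] tri (k ∸ c) ≡ k ^ 3 + 3 * k ^ 2 + 2 * k
tetrahedral zero = cong (6 *_) (∑-zero {0} λ _ ())
tetrahedral (suc k) = begin
  6 * ∑[ c < suc k ] tri (suc k ∸ c)                      ≡⟨ cong (6 *_) (∑-suc k _) ⟩
  6 * (tri (suc k) + ∑[ c < k ] tri (k ∸ c))              ≡⟨ distrib (tri (suc k)) _ ⟩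
  3 * (tri (suc k) * 2) + 6 * ∑[ c < k ] tri (k ∸ c)      ≡⟨ cong₂ (λ t s → 3 * t + s) (tri*2 (suc k)) (tetrahedral k) ⟩
  3 * (suc k * (suc k + 1)) + (k ^ 3 + 3 * k ^ 2 + 2 * k) ≡⟨ step k ⟩
  suc k ^ 3 + 3 * suc k ^ 2 + 2 * suc k                   ∎
  where
  open ≡-Reasoning
  distrib : ∀ t s → 6 * (t + s) ≡ 3 * (t * 2) + 6 * s
  distrib = solve-∀
  -- k ^ 3 unfolded: the ring solver does not read _^_ on ℕ.
  step : ∀ k → 3 * ((1 + k) * ((1 + k) + 1)) + (k * (k * (k * 1)) + 3 * (k * (k * 1)) + 2 * k)
             ≡ (1 + k) * ((1 + k) * ((1 + k) * 1)) + 3 * ((1 + k) * ((1 + k) * 1)) + 2 * (1 + k)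
  step = solve-∀

IsMax-exists : ∀ {P : ℕ → Set} → Decidable P → ∀ B → (∀ i → P i → i ≤ B) → ∀ {w} → P w → ∃[ m ] IsMax P m
IsMax-exists P? zero ≤B {w} Pw = w , Pw , λ i Pi → ≤-trans (≤B i Pi) z≤n
IsMax-exists {P} P? (suc B) ≤1+B Pw with P? (suc B)
... | yes P[1+B] = suc B , P[1+B] , ≤1+B
... | no ¬P[1+B] = IsMax-exists P? B ≤B Pw
  where
  ≤B : ∀ i → P i → i ≤ B
  ≤B i Pi = ≤-pred (≤∧≢⇒< (≤1+B i Pi) λ { refl → ¬P[1+B] Pi })

max-above : ∀ {P : ℕ → Set} → Decidable P → ∀ {B} → (∀ i → P i → i ≤ B) → ∀ {w} → P w →
            ∃[ m ] (IsMax P m × w ≤ m)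
max-above P? {B} ≤B {w} Pw with IsMax-exists P? B ≤B Pw
... | m , Pm , maximal = m , (Pm , maximal) , maximal w Pw

∃-bounded-list? : ∀ {P : List ℕ → Set} → Decidable P → ∀ k b →
                  Dec (∃[ xs ] (length xs ≡ k × All (_< b) xs × P xs))
∃-bounded-list? P? zero b = map′ (λ P[] → [] , refl , [] , P[]) (λ { ([] , _ , _ , P[]) → P[] ; (_ ∷ _ , () , _) }) (P? [])
∃-bounded-list? {P} P? (suc k) b =
  map′ cons uncons (anyUpTo? (λ x → ∃-bounded-list? (P? ∘ (x ∷_)) k b) b)
  where
  cons : ∃[ x ] (x < b × ∃[ xs ] (length xs ≡ k × All (_< b) xs × P (x ∷ xs))) →
         ∃[ xs ] (length xs ≡ suc k × All (_< b) xs × P xs)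
  cons (x , x<b , xs , len , xs<b , Px∷xs) = x ∷ xs , cong suc len , x<b ∷ xs<b , Px∷xs
  uncons : ∃[ xs ] (length xs ≡ suc k × All (_< b) xs × P xs) →
           ∃[ x ] (x < b × ∃[ xs ] (length xs ≡ k × All (_< b) xs × P (x ∷ xs)))
  uncons (x ∷ xs , len , x<b ∷ xs<b , Px∷xs) = x , x<b , xs , suc-injective len , xs<b , Px∷xs

entries≤sum : ∀ xs → All (_≤ sum xs) xs
entries≤sum [] = []
entries≤sum (x ∷ xs) = m≤m+n x (sum xs) ∷ All.map (λ y≤Σ → ≤-trans y≤Σ (m≤n+m (sum xs) x)) (entries≤sum xs)

sum≤Sm : ∀ xs → sum xs ≤ Sm xs
sum≤Sm [] = z≤n
sum≤Sm (x ∷ xs) = +-mono-≤ (subst (x ≤_) (sym (tri-closed x)) (n≤tri x)) (sum≤Sm xs)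

InI? : ∀ r k → Decidable (InI r k)
InI? r k xs = (length xs ≟ k) ×-dec linked? _>?_ xs ×-dec all? (0 <?_) xs ×-dec (sum xs ≟ r)

MCond? : ∀ p k → Decidable (MCond p k)
MCond? p k r = ((k * (k + 1)) / 2 ≤? r) ×-dec map′ forget remember (∃-bounded-list? InI∧Sm? k (suc r))
  where
  InI∧Sm? : Decidable (λ xs → InI r k xs × Sm xs ≤ p)
  InI∧Sm? xs = InI? r k xs ×-dec (Sm xs ≤? p)
  forget : ∃[ xs ] (length xs ≡ k × All (_< suc r) xs × InI r k xs × Sm xs ≤ p) → ∃[ xs ] (InI r k xs × Sm xs ≤ p)
  forget (xs , _ , _ , q) = xs , q
  remember : ∃[ xs ] (InI r k xs × Sm xs ≤ p) → ∃[ xs ] (length xs ≡ k × All (_< suc r) xs × InI r k xs × Sm xs ≤ p)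
  remember (xs , q@((len , _ , _ , Σ≡r) , _)) =
    xs , len , All.map (λ x≤Σ → s≤s (≤-trans x≤Σ (≤-reflexive Σ≡r))) (entries≤sum xs) , q

MCond⇒≤ : ∀ p k r → MCond p k r → r ≤ p
MCond⇒≤ p k r (_ , xs , (_ , _ , _ , Σ≡r) , Sm≤p) = subst (_≤ p) Σ≡r (≤-trans (sum≤Sm xs) Sm≤p)

LCond? : ∀ p → Decidable (LCond p)
LCond? p i = _ ≤? _

LCond⇒≤ : ∀ p i → LCond p i → i ≤ 6 * p
LCond⇒≤ p i cubic≤6p = ≤-trans (≤-trans (m≤n*m i 2) (m≤n+m (2 * i) (i ^ 3 + 3 * i ^ 2))) cubic≤6p

module Staircase (J : TermSet) (ideal : IsMonomialIdeal J) (stable : IsStable J) where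

  outside : ℕ → ℕ → ℕ → Bool
  outside a b c = not (J (a , b , c))

  N : ℕ → ℕ → ℕ → Set
  N a b c = outside a b c ≡ true

  N-down₁ : ∀ {a b c} → N (suc a) b c → N a b c
  N-down₁ = contraposeᵇ (proj₁ ∘ ideal _ _ _)

  N-down₂ : ∀ {a b c} → N a (suc b) c → N a b c
  N-down₂ = contraposeᵇ (proj₁ ∘ proj₂ ∘ ideal _ _ _)

  N-down₃ : ∀ {a b c} → N a b (suc c) → N a b c
  N-down₃ = contraposeᵇ (proj₂ ∘ proj₂ ∘ ideal _ _ _)

  N-down : ∀ {a′ b′ c′ a b c} → a′ ≤ a → b′ ≤ b → c′ ≤ c → N a b c → N a′ b′ c′
  N-down {a′} {b′} {c′} {a} {b} {c} a′≤a b′≤b c′≤c =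
      antitone-≤ {λ x → N x b′ c′} N-down₁ a′≤a
    ∘ antitone-≤ {λ y → N a y c′} N-down₂ b′≤b
    ∘ antitone-≤ {λ z → N a b z} N-down₃ c′≤c

  N-step₁₂ : ∀ {a b c} → N a (suc b) c → N (suc a) b c
  N-step₁₂ = contraposeᵇ (proj₁ ∘ proj₁ stable _ _ _)

  N-step₂₃ : ∀ {b c} → N 0 b (suc c) → N 0 (suc b) c
  N-step₂₃ = contraposeᵇ (proj₂ stable _ _)

  N-shift₁₂ : ∀ a {b c} → N 0 (a + b) c → N a b c
  N-shift₁₂ a {c = c} = shift {λ x y → N x y c} N-step₁₂ a

  N-shift₂₃ : ∀ b {c} → N 0 0 (b + c) → N 0 b c
  N-shift₂₃ = shift {λ x y → N 0 x y} N-step₂₃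

  any-outside₁ : ∀ d b c → any (λ a → outside a b c) (upTo (suc d)) ≡ outside 0 b c
  any-outside₁ d b c = any-head (N-down z≤n ≤-refl ≤-refl) (applyUpTo suc d)

  any-outside₂ : ∀ d a c → any (λ b → outside a b c) (upTo (suc d)) ≡ outside a 0 c
  any-outside₂ d a c = any-head (N-down ≤-refl z≤n ≤-refl) (applyUpTo suc d)

  affineHF-as-∑ : ∀ D → affineHF J D ≡
    ∑[ a < suc D ] ∑[ b < suc (D ∸ a) ] ∑[ c < suc (D ∸ a ∸ b) ] 𝟙 (outside a b c)
  affineHF-as-∑ D =
    trans (countᵇ-concatMap-upTo g slice (suc D)) (∑-cong λ a _ →
    trans (countᵇ-concatMap-upTo g (column a) (suc (D ∸ a))) (∑-cong λ b _ →
    countᵇ-map-upTo g (λ c → a , b , c) (suc (D ∸ a ∸ b))))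
    where
    g : Term → Bool
    g t = not (J t)
    column : ℕ → ℕ → List Term
    column a b = map (λ c → a , b , c) (upTo (suc (D ∸ a ∸ b)))
    slice : ℕ → List Term
    slice a = concatMap (column a) (upTo (suc (D ∸ a)))

  mu2-as-∑ : ∀ d → mu2UpTo J d ≡ ∑[ b < suc d ] ∑[ c < suc d ] 𝟙 (outside 0 b c)
  mu2-as-∑ d =
    trans (countᵇ-concatMap-upTo g row (suc d)) (∑-cong λ b _ →
    trans (countᵇ-map-upTo g (b ,_) (suc d)) (∑-cong λ c _ →
    cong 𝟙 (any-outside₁ d b c)))
    where
    g : ℕ × ℕ → Bool
    g (b , c) = any (λ a → outside a b c) (upTo (suc d))
    row : ℕ → List (ℕ × ℕ)
    row b = map (b ,_) (upTo (suc d))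

  mu3-as-∑ : ∀ d → mu3UpTo J d ≡ ∑[ c < suc d ] 𝟙 (outside 0 0 c)
  mu3-as-∑ d = trans (countᵇ-applyUpTo g id (suc d)) (∑-cong λ c _ →
    cong 𝟙 (trans (any-cong (λ a → any-outside₂ d a c) (upTo (suc d))) (any-outside₁ d 0 c)))
    where
    g : ℕ → Bool
    g c = any (λ a → any (λ b → outside a b c) (upTo (suc d))) (upTo (suc d))

module BarList (p : ℕ) (1≤p : 1 ≤ p) (J : TermSet) (ideal : IsMonomialIdeal J) (stable : IsStable J)
               (h k d₀ : ℕ) (bar : ∀ d → d₀ ≤ d → (affineHF J d ≡ p) × (mu2UpTo J d ≡ h) × (mu3UpTo J d ≡ k))
               where

  open Staircase J ideal stable

  -- d ≥ d₀ so that the bar list is read off in the box [0,d]³, d ≥ p so that N(J) fits in it,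
  -- and the box lies in the simplex of degree D.
  d : ℕ
  d = d₀ + p

  D : ℕ
  D = d + (d + d)

  hilbert : affineHF J D ≡ p
  hilbert = proj₁ (bar D (≤-trans (m≤m+n d₀ p) (m≤m+n d (d + d))))

  mu2≡h : mu2UpTo J d ≡ h
  mu2≡h = proj₁ (proj₂ (bar d (m≤m+n d₀ p)))

  mu3≡k : mu3UpTo J d ≡ k
  mu3≡k = proj₂ (proj₂ (bar d (m≤m+n d₀ p)))

  box-within-simplex : ∀ {a b} → a < suc d → b < suc d → suc d ≤ suc (D ∸ a ∸ b)
  box-within-simplex {a} {b} (s≤s a≤d) (s≤s b≤d) = s≤s (begin
    d               ≡⟨ sym (m+n∸n≡m d (d + d)) ⟩
    D ∸ (d + d)     ≤⟨ ∸-monoʳ-≤ D (+-mono-≤ a≤d b≤d) ⟩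
    D ∸ (a + b)     ≡⟨ sym (∸-+-assoc D a b) ⟩
    D ∸ a ∸ b       ∎)
    where open ≤-Reasoning

  box : ℕ
  box = ∑[ a < suc d ] ∑[ b < suc d ] ∑[ c < suc d ] 𝟙 (outside a b c)

  box≤p : box ≤ p
  box≤p = begin
    box
      ≤⟨ ∑-mono (box-within-simplex {0} {0} z<s z<s) (λ a a<1+d →
         ∑-mono (box-within-simplex a<1+d z<s) (λ b b<1+d →
         ∑-mono (box-within-simplex a<1+d b<1+d) (λ _ _ → ≤-refl))) ⟩
    ∑[ a < suc D ] ∑[ b < suc (D ∸ a) ] ∑[ c < suc (D ∸ a ∸ b) ] 𝟙 (outside a b c)
      ≡⟨ sym (affineHF-as-∑ D) ⟩
    affineHF J D
      ≡⟨ hilbert ⟩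
    p ∎
    where open ≤-Reasoning

  origin∈N : N 0 0 0
  origin∈N = decidable-stable (isTrue (outside 0 0 0)) λ origin∉N → <⇒≱ 1≤p (begin
    p            ≡⟨ sym hilbert ⟩
    affineHF J D ≡⟨ affineHF-as-∑ D ⟩
    _            ≡⟨ ∑-zero (λ a _ → ∑-zero λ b _ → ∑-zero λ c _ →
                      𝟙-¬ (origin∉N ∘ N-down z≤n z≤n z≤n)) ⟩
    0            ∎)
    where open ≤-Reasoning

  ¬N-far : ∀ c → ¬ N 0 d c
  ¬N-far c N0dc = <⇒≱ (s≤s (m≤n+m p d₀)) (begin
    suc d                                      ≤⟨ ∑-lower ≤-refl (λ b b<1+d → 1≤𝟙 (N-down z≤n (≤-pred b<1+d) z≤n N0dc)) ⟩
    ∑[ b < suc d ] 𝟙 (outside 0 b 0)           ≤⟨ ∑-mono ≤-refl (λ b _ → term≤∑ {i = 0} z<s) ⟩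
    ∑[ b < suc d ] ∑[ c < suc d ] 𝟙 (outside 0 b c) ≤⟨ term≤∑ {i = 0} z<s ⟩
    box                                        ≤⟨ box≤p ⟩
    p                                          ∎)
    where open ≤-Reasoning

  module Column = AntitoneCount (λ c → outside 0 0 c) N-down₃
  module Row (c : ℕ) = AntitoneCount (λ b → outside 0 b c) N-down₂

  k≡count : k ≡ ∑[ c < suc d ] 𝟙 (outside 0 0 c)
  k≡count = trans (sym mu3≡k) (mu3-as-∑ d)

  k≤1+d : k ≤ suc d
  k≤1+d = subst (_≤ suc d) (sym k≡count) (∑-upper (λ c _ → 𝟙≤1 _))

  1≤k : 1 ≤ k
  1≤k = subst (1 ≤_) (sym k≡count) (Column.true⇒<count (suc d) origin∈N z<s)

  N-below-k : ∀ {c} → c < k → N 0 0 c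
  N-below-k c<k = Column.<count⇒true (suc d) (subst (_ <_) k≡count c<k)

  ¬N-above-k : ∀ {c} → k ≤ c → c < suc d → ¬ N 0 0 c
  ¬N-above-k k≤c c<1+d N00c = <⇒≱ (Column.true⇒<count (suc d) N00c c<1+d) (subst (_≤ _) k≡count k≤c)

  row : ℕ → ℕ
  row c = ∑[ b < suc d ] 𝟙 (outside 0 b c)

  row≤1+d : ∀ c → row c ≤ suc d
  row≤1+d c = ∑-upper (λ b _ → 𝟙≤1 _)

  k∸c≤row : ∀ c → k ∸ c ≤ row c
  k∸c≤row c = ∑-lower (≤-trans (m∸n≤m k c) k≤1+d) λ b b<k∸c →
    1≤𝟙 (N-shift₂₃ b (N-below-k (subst (_< k) (+-comm c b) (m<n∸o⇒o+m<n k c b<k∸c))))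

  row-decreasing : ∀ {c} → N 0 0 c → row (suc c) < row c
  row-decreasing {c} N00c = begin-strict
    row (suc c)                                        ≡⟨ ∑-snoc d _ ⟩
    ∑[ b < d ] 𝟙 (outside 0 b (suc c)) + 𝟙 (outside 0 d (suc c)) ≡⟨ cong (∑[ b < d ] 𝟙 (outside 0 b (suc c)) +_) (𝟙-¬ (¬N-far (suc c))) ⟩
    ∑[ b < d ] 𝟙 (outside 0 b (suc c)) + 0             ≡⟨ +-identityʳ _ ⟩
    ∑[ b < d ] 𝟙 (outside 0 b (suc c))                 ≤⟨ ∑-mono ≤-refl (λ b _ → 𝟙-mono N-step₂₃) ⟩
    ∑[ b < d ] 𝟙 (outside 0 (suc b) c)                 <⟨ +-monoˡ-≤ _ (1≤𝟙 N00c) ⟩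
    𝟙 (outside 0 0 c) + ∑[ b < d ] 𝟙 (outside 0 (suc b) c) ≡⟨ sym (∑-suc d _) ⟩
    row c                                              ∎
    where open ≤-Reasoning

  layer : ℕ → ℕ
  layer c = ∑[ a < suc d ] ∑[ b < suc d ] 𝟙 (outside a b c)

  tri-row≤layer : ∀ c → tri (row c) ≤ layer c
  tri-row≤layer c = begin
    tri (row c)                 ≡⟨ sym (tri-as-∑ (row c)) ⟩
    ∑[ a < row c ] (row c ∸ a)  ≤⟨ ∑-mono (row≤1+d c) (λ a _ →
                                     ∑-lower (≤-trans (m∸n≤m (row c) a) (row≤1+d c)) λ b b<row∸a →
                                     1≤𝟙 (N-shift₁₂ a (Row.<count⇒true c (suc d) (m<n∸o⇒o+m<n (row c) a b<row∸a)))) ⟩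
    layer c                     ∎
    where open ≤-Reasoning

  box≡∑layer : box ≡ ∑[ c < suc d ] layer c
  box≡∑layer = trans (∑-cong λ a _ → ∑-comm (suc d) (suc d) λ b c → 𝟙 (outside a b c))
                     (∑-comm (suc d) (suc d) λ a c → ∑[ b < suc d ] 𝟙 (outside a b c))

  ∑tri-row≤p : ∑[ c < k ] tri (row c) ≤ p
  ∑tri-row≤p = begin
    ∑[ c < k ] tri (row c)   ≤⟨ ∑-mono k≤1+d (λ c _ → tri-row≤layer c) ⟩
    ∑[ c < suc d ] layer c   ≡⟨ sym box≡∑layer ⟩
    box                      ≤⟨ box≤p ⟩
    p                        ∎
    where open ≤-Reasoning

  h≡∑row : h ≡ ∑[ c < k ] row c
  h≡∑row = begin
    h                                                ≡⟨ sym mu2≡h ⟩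
    mu2UpTo J d                                      ≡⟨ mu2-as-∑ d ⟩
    ∑[ b < suc d ] ∑[ c < suc d ] 𝟙 (outside 0 b c) ≡⟨ ∑-comm (suc d) (suc d) _ ⟩
    ∑[ c < suc d ] row c                             ≡⟨ ∑-vanishing k≤1+d (λ c k≤c c<1+d → ∑-zero λ b _ →
                                                          𝟙-¬ (¬N-above-k k≤c c<1+d ∘ N-down ≤-refl z≤n ≤-refl)) ⟩
    ∑[ c < k ] row c                                 ∎
    where open ≡-Reasoning

  partition : List ℕ
  partition = applyUpTo row k

  partition∈I : InI h k partition
  partition∈I =
      length-applyUpTo row k
    , applyUpTo-Linked row k (λ 1+c<k → row-decreasing (N-below-k (<-trans (n<1+n _) 1+c<k)))
    , applyUpTo⁺₁ row k (λ c<k → ≤-trans (m<n⇒0<n∸m c<k) (k∸c≤row _))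
    , trans (sym (∑-as-sum k row)) (sym h≡∑row)

  Sm-partition : Sm partition ≡ ∑[ c < k ] tri (row c)
  Sm-partition = begin
    sum (map (λ a → (a * (a + 1)) / 2) (applyUpTo row k)) ≡⟨ cong sum (map-applyUpTo row _ k) ⟩
    sum (applyUpTo (λ c → (row c * (row c + 1)) / 2) k)  ≡⟨ sym (∑-as-sum k _) ⟩
    ∑[ c < k ] ((row c * (row c + 1)) / 2)               ≡⟨ ∑-cong (λ c _ → tri-closed (row c)) ⟩
    ∑[ c < k ] tri (row c)                               ∎
    where open ≡-Reasoning

  T[k]≤h : (k * (k + 1)) / 2 ≤ h
  T[k]≤h = begin
    (k * (k + 1)) / 2    ≡⟨ tri-closed k ⟩
    tri k                ≡⟨ sym (tri-as-∑ k) ⟩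
    ∑[ c < k ] (k ∸ c)   ≤⟨ ∑-mono ≤-refl (λ c _ → k∸c≤row c) ⟩
    ∑[ c < k ] row c     ≡⟨ sym h≡∑row ⟩
    h                    ∎
    where open ≤-Reasoning

  h∈M : MCond p k h
  h∈M = T[k]≤h , partition , partition∈I , subst (_≤ p) (sym Sm-partition) ∑tri-row≤p

  k∈L : LCond p k
  k∈L = subst (_≤ 6 * p) (tetrahedral k)
    (*-monoʳ-≤ 6 (≤-trans (∑-mono ≤-refl λ c _ → tri-mono (k∸c≤row c)) ∑tri-row≤p))

mainTheorem9 : (p : ℕ) → 1 ≤ p →
    (J : TermSet) → IsMonomialIdeal J → IsStable J →
    HasConstantHilbertPolynomial J p →
    (h k : ℕ) → IsBarListOfN J p h k →
    (1 ≤ k) × (∃[ l ] (IsMax (LCond p) l × k ≤ l)) ×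
    ((k * (k + 1)) / 2 ≤ h) × (∃[ m ] (IsMax (MCond p k) m × h ≤ m))
-- The constant Hilbert polynomial is already contained in the bar-list hypothesis.
mainTheorem9 p 1≤p J ideal stable _ h k (d₀ , bar) =
    1≤k
  , max-above (LCond? p) (LCond⇒≤ p) k∈L
  , T[k]≤h
  , max-above (MCond? p k) (MCond⇒≤ p k) h∈M
  where open BarList p 1≤p J ideal stable h k d₀ bar
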